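{- Let $k\ge4$ be an integer and $G=([N],E)$ a graph. Every vertex $v\in[N]$ belongs to at most $|\Gamma_G(v)|/2$ distinct $k$-spots of $G$; consequently, the number of $k$-spots of $G$ is at most $|E|$.
   Context: $\Gamma_G(v)$ is the set of neighbors of $v$ in $G$. For $S\subseteq[N]$, $G_S$ is the induced subgraph. A set $S\subseteq[N]$ is a $k$-spot of $G$ if: (1) $G_S$ contains no simple cycle of length at least $k$; (2) $|S|\ge3$ and $G_S$ is 2-vertex-connected; (3) for all distinct $u,v\in S$, every path in $G$ from $u$ to $v$ all of whose intermediate vertices lie in $[N]\setminus S$, if any exists, has length at least $2k$. -}

module Defs where

open import Data.Bool using (Bool; true; false; T; _∧_)
open import Data.Nat using (ℕ; _≤_; _+_; _*_; _<ᵇ_)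
open import Data.Fin using (Fin; toℕ)
open import Data.Fin.Subset using (Subset; _∈_; _∉_; ∣_∣)
open import Data.List using (List; []; _∷_; _++_; [_]; length; filterᵇ; cartesianProduct; allFin; last)
open import Data.List.Relation.Unary.All using (All)
open import Data.List.Relation.Unary.Unique.Propositional using (Unique)
open import Data.List.Relation.Unary.Linked using (Linked)
open import Data.Maybe using (just)
open import Data.Product using (_×_; Σ; ∃; _,_; proj₁; proj₂)
open import Data.Sum using (_⊎_)
open import Data.Vec using (tabulate)
open import Relation.Binary.PropositionalEquality using (_≡_; _≢_)
open import Relation.Nullary using (¬_)

record Graph (N : ℕ) : Set where
  field
    adj       : Fin N → Fin N → Bool
    adj-sym   : ∀ u v → adj u v ≡ adj v u
    adj-irref : ∀ v → adj v v ≡ false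

module _ {N : ℕ} (G : Graph N) where
  open Graph G

  Adj : Fin N → Fin N → Set
  Adj u v = T (adj u v)

  degree : Fin N → ℕ
  degree v = ∣ tabulate (adj v) ∣

  edgeCount : ℕ
  edgeCount = length (filterᵇ (λ p → (toℕ (proj₁ p) <ᵇ toℕ (proj₂ p)) ∧ adj (proj₁ p) (proj₂ p))
                              (cartesianProduct (allFin N) (allFin N)))

  InducedConnected : (Fin N → Set) → Set
  InducedConnected P = ∀ u w → P u → P w →
    u ≡ w ⊎ Σ (List (Fin N)) (λ mid → All P mid × Linked Adj (u ∷ mid ++ [ w ]))

  HasLongCycle : ℕ → Subset N → Set
  HasLongCycle k S = Σ (Fin N) λ x → Σ (List (Fin N)) λ xs →
    Unique (x ∷ xs) × All (_∈ S) (x ∷ xs) × Linked Adj (x ∷ xs) ×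
    Σ (Fin N) (λ y → last (x ∷ xs) ≡ just y × Adj y x) ×
    3 ≤ length (x ∷ xs) × k ≤ length (x ∷ xs)

  -- G_S is 2-vertex-connected (|S| ≥ 3 is stated separately in IsKSpot):
  -- connected, and remains connected after deleting any single vertex.
  TwoConnected : Subset N → Set
  TwoConnected S = InducedConnected (_∈ S) ×
    (∀ x → x ∈ S → InducedConnected (λ y → y ∈ S × y ≢ x))

  -- A path u, mid..., w in G (distinct vertices, consecutive adjacent) with at
  -- least one intermediate vertex, all intermediate vertices outside S,
  -- must have length (length mid + 1) at least 2k.
  FarApart : ℕ → Subset N → Set
  FarApart k S = ∀ u w → u ∈ S → w ∈ S → u ≢ w → (mid : List (Fin N)) →
    ¬ (mid ≡ []) → All (_∉ S) mid →
    Unique (u ∷ mid ++ [ w ]) → Linked Adj (u ∷ mid ++ [ w ]) →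
    2 * k ≤ length mid + 1

  IsKSpot : ℕ → Subset N → Set
  IsKSpot k S = ¬ HasLongCycle k S × (3 ≤ ∣ S ∣ × TwoConnected S) × FarApart k S

module Submission where

--   two k-spots S, T containing both ends of an edge v – w are equal.
--
-- Were x ∈ T ∖ S, then, T being 2-connected, some path v → w inside T
-- passes through x (proved by rerouting a path through v step by step
-- along a walk towards x, using that T minus any vertex stays connected).
-- Around x this path leaves S: it contains an excursion a → b between
-- vertices of S with all inner vertices outside S.  As S is a k-spot that
-- excursion has more than 2k vertices, so the path closed by the edge
-- w – v is a cycle of length > 2k inside T, which T does not allow.
--
-- Consequently the neighbours of v inside the spots through v (two per
-- spot, by 2-connectivity) are all distinct, and so are edges chosen inside
-- each spot; the theorem follows by counting such private witnesses.

open import Defs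
open import Data.Bool using (Bool; true; false; T; _∧_)
open import Data.Bool.Properties using (T-≡; T-∧)
open import Data.Empty using (⊥; ⊥-elim)
open import Data.Fin as Fin using (Fin; zero; suc; toℕ)
open import Data.Fin.Properties using (any?; toℕ-injective; suc-injective) renaming (_≟_ to _≟ᶠ_)
open import Data.Fin.Subset using (Subset; _∈_; _∉_; _⊆_; ∣_∣)
open import Data.Fin.Subset.Properties using (⊆-antisym) renaming (_∈?_ to _∈ˢ?_)
open import Data.List using (List; []; _∷_; _++_; [_]; length; map; last; filterᵇ; cartesianProduct; allFin)
open import Data.List.Properties using (length-map; length-++)
open import Data.List.Membership.Propositional using () renaming (_∈_ to _∈ₗ_; _∉_ to _∉ₗ_)
open import Data.List.Membership.Propositional.Properties
  using (∈-map⁺; ∈-map⁻; ∈-++⁺ˡ; ∈-++⁺ʳ; ∈-++⁻; ∈-filter⁺; ∈-cartesianProduct⁺; ∈-allFin)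
open import Data.List.Relation.Binary.Subset.Propositional using () renaming (_⊆_ to _⊆ₗ_)
open import Data.List.Relation.Unary.All as All using (All; []; _∷_)
open import Data.List.Relation.Unary.All.Properties.Core using (¬Any⇒All¬; All¬⇒¬Any)
open import Data.List.Relation.Unary.Any using (here; there; _─_)
open import Data.List.Relation.Unary.AllPairs using ([]; _∷_)
open import Data.List.Relation.Unary.Linked using (Linked; []; [-]; _∷_)
open import Data.List.Relation.Unary.Unique.Propositional using (Unique)
import Data.List.Relation.Unary.Unique.Propositional.Properties as UniqueProperties
import Data.List.Membership.DecPropositional as DecMembership
open import Data.Maybe using (just)
open import Data.Nat using (ℕ; suc; _≤_; _<_; _+_; _*_; _<ᵇ_; z≤n; s≤s)
open import Data.Nat.Properties
  using (≤-trans; m≤n*m; m≤n⇒m≤1+n; +-monoˡ-≤; n≤1+n; <⇒≱; *-suc; *-zeroʳ; *-identityˡ; <⇒<ᵇ; <-cmp)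
open import Data.Product using (Σ; ∃-syntax; _×_; _,_; proj₁; proj₂)
open import Data.Sum using (_⊎_; inj₁; inj₂; swap; [_,_]′)
open import Data.Vec using ([]; _∷_; tabulate; here; there)
open import Data.Vec.Properties using (lookup⇒[]=; lookup∘tabulate)
open import Function.Bundles using (Equivalence)
open import Relation.Binary.Definitions using (tri<; tri≈; tri>)
open import Relation.Binary.PropositionalEquality using (_≡_; _≢_; refl; sym; trans; cong; cong₂; subst)
open Relation.Binary.PropositionalEquality.≡-Reasoning
open import Relation.Nullary using (¬_; yes; no; Dec; ¬?)
open import Relation.Nullary.Decidable using (_×-dec_; T?)

module _ {A : Set} where

  length-─ : ∀ {x : A} {ys} (x∈ys : x ∈ₗ ys) → suc (length (ys ─ x∈ys)) ≡ length ys
  length-─ (here _) = refl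
  length-─ (there x∈ys) = cong suc (length-─ x∈ys)

  ∈-─ : ∀ {x z : A} {ys} (x∈ys : x ∈ₗ ys) → z ∈ₗ ys → z ≢ x → z ∈ₗ (ys ─ x∈ys)
  ∈-─ (here refl) (here refl) z≢x = ⊥-elim (z≢x refl)
  ∈-─ (here _) (there z∈ys) _ = z∈ys
  ∈-─ (there _) (here z≡y) _ = here z≡y
  ∈-─ (there x∈ys) (there z∈ys) z≢x = there (∈-─ x∈ys z∈ys z≢x)

  unique-∷ : ∀ {x : A} {xs} → x ∉ₗ xs → Unique xs → Unique (x ∷ xs)
  unique-∷ x∉xs uxs = ¬Any⇒All¬ _ x∉xs ∷ uxs

  unique-head : ∀ {x : A} {xs} → Unique (x ∷ xs) → x ∉ₗ xs
  unique-head (x∉xs ∷ _) = All¬⇒¬Any x∉xs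

  unique-tail : ∀ {x : A} {xs} → Unique (x ∷ xs) → Unique xs
  unique-tail (_ ∷ uxs) = uxs

  unique-last : ∀ {y : A} xs → Unique (xs ++ [ y ]) → y ∉ₗ xs
  unique-last (x ∷ xs) uxs (here refl) = unique-head uxs (∈-++⁺ʳ xs (here refl))
  unique-last (x ∷ xs) uxs (there y∈xs) = unique-last xs (unique-tail uxs) y∈xs

  unique-⊆⇒length≤ : ∀ {xs ys : List A} → Unique xs → xs ⊆ₗ ys → length xs ≤ length ys
  unique-⊆⇒length≤ {[]} _ _ = z≤n
  unique-⊆⇒length≤ {x ∷ xs} {ys} (x∉xs ∷ uxs) xs⊆ys =
    subst (suc (length xs) ≤_) (length-─ x∈ys)
      (s≤s (unique-⊆⇒length≤ uxs (λ z∈xs → ∈-─ x∈ys (xs⊆ys (there z∈xs)) (z≢x z∈xs))))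
    where
    x∈ys = xs⊆ys (here refl)
    z≢x : ∀ {z} → z ∈ₗ xs → z ≢ x
    z≢x z∈xs refl = unique-head (x∉xs ∷ uxs) z∈xs

module _ {A B : Set} (Owns : B → A → Set) where

  Witnessed : ℕ → B → Set
  Witnessed m S = Σ (List A) λ ws → Unique ws × length ws ≡ m × All (Owns S) ws

  private
    collect : ∀ {m} → (∀ {S T z} → Owns S z → Owns T z → S ≡ T) →
      ∀ Ss → Unique Ss → All (Witnessed m) Ss →
      Σ (List A) λ L → Unique L × length L ≡ m * length Ss × (∀ {z} → z ∈ₗ L → ∃[ S ] S ∈ₗ Ss × Owns S z)
    collect {m} _ [] _ _ = [] , [] , sym (*-zeroʳ m) , λ ()
    collect {m} private-witness (S ∷ Ss) uSs ((ws , uws , |ws| , owned) ∷ witnessed)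
      with collect private-witness Ss (unique-tail uSs) witnessed
    ... | L , uL , |L| , owner = ws ++ L , UniqueProperties.++⁺ uws uL disjoint , length-ws++L , owner′
      where
      disjoint : ∀ {z} → ¬ (z ∈ₗ ws × z ∈ₗ L)
      disjoint (z∈ws , z∈L) with owner z∈L
      ... | T , T∈Ss , T-owns =
        unique-head uSs (subst (_∈ₗ Ss) (private-witness T-owns (All.lookup owned z∈ws)) T∈Ss)
      length-ws++L : length (ws ++ L) ≡ m * suc (length Ss)
      length-ws++L = begin
        length (ws ++ L)       ≡⟨ length-++ ws ⟩
        length ws + length L   ≡⟨ cong₂ _+_ |ws| |L| ⟩
        m + m * length Ss      ≡⟨ sym (*-suc m (length Ss)) ⟩
        m * suc (length Ss)    ∎
      owner′ : ∀ {z} → z ∈ₗ ws ++ L → ∃[ T ] T ∈ₗ S ∷ Ss × Owns T z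
      owner′ z∈ with ∈-++⁻ ws z∈
      ... | inj₁ z∈ws = S , here refl , All.lookup owned z∈ws
      ... | inj₂ z∈L with owner z∈L
      ...   | T , T∈Ss , T-owns = T , there T∈Ss , T-owns

  witness-count : ∀ m (ys : List A) → (∀ {S T z} → Owns S z → Owns T z → S ≡ T) →
    (∀ {S z} → Owns S z → z ∈ₗ ys) →
    ∀ Ss → Unique Ss → All (Witnessed m) Ss → m * length Ss ≤ length ys
  witness-count m ys private-witness from-ys Ss uSs witnessed
    with collect private-witness Ss uSs witnessed
  ... | L , uL , |L| , owner =
    subst (_≤ length ys) |L| (unique-⊆⇒length≤ uL (λ z∈L → from-ys (proj₂ (proj₂ (owner z∈L)))))

elements : ∀ {n} → Subset n → List (Fin n)
elements [] = []
elements (true ∷ p) = zero ∷ map suc (elements p)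
elements (false ∷ p) = map suc (elements p)

length-elements : ∀ {n} (p : Subset n) → length (elements p) ≡ ∣ p ∣
length-elements [] = refl
length-elements (true ∷ p) = cong suc (trans (length-map suc (elements p)) (length-elements p))
length-elements (false ∷ p) = trans (length-map suc (elements p)) (length-elements p)

∈-elements⁺ : ∀ {n} {x : Fin n} (p : Subset n) → x ∈ p → x ∈ₗ elements p
∈-elements⁺ (true ∷ p) here = here refl
∈-elements⁺ (true ∷ p) (there x∈p) = there (∈-map⁺ suc (∈-elements⁺ p x∈p))
∈-elements⁺ (false ∷ p) (there x∈p) = ∈-map⁺ suc (∈-elements⁺ p x∈p)

∈-elements⁻ : ∀ {n} {x : Fin n} (p : Subset n) → x ∈ₗ elements p → x ∈ p
∈-elements⁻ (true ∷ p) (here refl) = here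
∈-elements⁻ (true ∷ p) (there x∈) with ∈-map⁻ suc x∈
... | y , y∈ , refl = there (∈-elements⁻ p y∈)
∈-elements⁻ (false ∷ p) x∈ with ∈-map⁻ suc x∈
... | y , y∈ , refl = there (∈-elements⁻ p y∈)

elements-unique : ∀ {n} (p : Subset n) → Unique (elements p)
elements-unique [] = []
elements-unique (true ∷ p) =
  unique-∷ zero∉ (UniqueProperties.map⁺ suc-injective (elements-unique p))
  where
  zero∉ : ∀ {n} {xs : List (Fin n)} → Fin.zero ∉ₗ map Fin.suc xs
  zero∉ z∈ with ∈-map⁻ Fin.suc z∈
  ... | _ , _ , ()
elements-unique (false ∷ p) = UniqueProperties.map⁺ suc-injective (elements-unique p)

_∈ₗ?_ : ∀ {n} (x : Fin n) (xs : List (Fin n)) → Dec (x ∈ₗ xs)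
_∈ₗ?_ = DecMembership._∈?_ _≟ᶠ_

fresh : ∀ {n} (S : Subset n) (xs : List (Fin n)) → length xs < ∣ S ∣ → ∃[ r ] r ∈ S × r ∉ₗ xs
fresh S xs |xs|<|S| with any? (λ r → (r ∈ˢ? S) ×-dec ¬? (r ∈ₗ? xs))
... | yes found = found
... | no none = ⊥-elim (too-small (unique-⊆⇒length≤ (elements-unique S) elements⊆xs))
  where
  elements⊆xs : elements S ⊆ₗ xs
  elements⊆xs {r} r∈ with r ∈ₗ? xs
  ... | yes r∈xs = r∈xs
  ... | no r∉xs = ⊥-elim (none (r , ∈-elements⁻ S r∈ , r∉xs))
  too-small : ¬ (length (elements S) ≤ length xs)
  too-small le = <⇒≱ |xs|<|S| (subst (_≤ length xs) (length-elements S) le)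

module Walks {N : ℕ} (G : Graph N) where
  open Graph G using (adj-sym; adj-irref)

  V : Set
  V = Fin N

  Adj-sym : ∀ {u v} → Adj G u v → Adj G v u
  Adj-sym {u} {v} = subst T (adj-sym u v)

  Adj-irrefl : ∀ {u v} → Adj G u v → u ≢ v
  Adj-irrefl {u} u~u refl = subst T (adj-irref u) u~u

  data Walk : V → V → Set where
    nil  : ∀ u → Walk u u
    cons : ∀ u {v w} → Adj G u v → Walk v w → Walk u w

  verts : ∀ {u w} → Walk u w → List V
  verts (nil u) = u ∷ []
  verts (cons u _ p) = u ∷ verts p

  infix 4 _∈ᵥ_
  _∈ᵥ_ : ∀ {u w} → V → Walk u w → Set
  x ∈ᵥ p = x ∈ₗ verts p

  Simple : ∀ {u w} → Walk u w → Set
  Simple p = Unique (verts p)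

  trivial-simple : ∀ x → Simple (nil x)
  trivial-simple x = unique-∷ (λ ()) []

  infixr 5 _++ᵂ_
  _++ᵂ_ : ∀ {u v w} → Walk u v → Walk v w → Walk u w
  nil _ ++ᵂ q = q
  cons u u~ p ++ᵂ q = cons u u~ (p ++ᵂ q)

  ++ᵂ-assoc : ∀ {u v w x} (p : Walk u v) (q : Walk v w) (r : Walk w x) →
    (p ++ᵂ q) ++ᵂ r ≡ p ++ᵂ q ++ᵂ r
  ++ᵂ-assoc (nil _) q r = refl
  ++ᵂ-assoc (cons u u~ p) q r = cong (cons u u~) (++ᵂ-assoc p q r)

  start∈ : ∀ {u w} (p : Walk u w) → u ∈ᵥ p
  start∈ (nil u) = here refl
  start∈ (cons u _ p) = here refl

  end∈ : ∀ {u w} (p : Walk u w) → w ∈ᵥ p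
  end∈ (nil u) = here refl
  end∈ (cons u _ p) = there (end∈ p)

  ∈-++ᵂ⁻ : ∀ {u v w z} (p : Walk u v) (q : Walk v w) → z ∈ᵥ p ++ᵂ q → z ∈ᵥ p ⊎ z ∈ᵥ q
  ∈-++ᵂ⁻ (nil _) q z∈ = inj₂ z∈
  ∈-++ᵂ⁻ (cons u _ p) q (here z≡u) = inj₁ (here z≡u)
  ∈-++ᵂ⁻ (cons u _ p) q (there z∈) with ∈-++ᵂ⁻ p q z∈
  ... | inj₁ z∈p = inj₁ (there z∈p)
  ... | inj₂ z∈q = inj₂ z∈q

  ∈-++ᵂˡ : ∀ {u v w z} (p : Walk u v) (q : Walk v w) → z ∈ᵥ p → z ∈ᵥ p ++ᵂ q
  ∈-++ᵂˡ (nil _) q (here refl) = start∈ q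
  ∈-++ᵂˡ (cons u _ p) q (here z≡u) = here z≡u
  ∈-++ᵂˡ (cons u _ p) q (there z∈p) = there (∈-++ᵂˡ p q z∈p)

  ∈-++ᵂʳ : ∀ {u v w z} (p : Walk u v) (q : Walk v w) → z ∈ᵥ q → z ∈ᵥ p ++ᵂ q
  ∈-++ᵂʳ (nil _) q z∈q = z∈q
  ∈-++ᵂʳ (cons u _ p) q z∈q = there (∈-++ᵂʳ p q z∈q)

  simple-++ : ∀ {u m w} (p : Walk u m) (q : Walk m w) → Simple p → Simple q →
    (∀ {z} → z ∈ᵥ p → z ∈ᵥ q → z ≡ m) → Simple (p ++ᵂ q)
  simple-++ (nil _) q _ sq _ = sq
  simple-++ (cons u _ p) q sp sq meet =
    unique-∷ u∉ (simple-++ p q (unique-tail sp) sq (λ z∈p → meet (there z∈p)))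
    where
    u∉ : u ∉ₗ verts (p ++ᵂ q)
    u∉ u∈ with ∈-++ᵂ⁻ p q u∈
    ... | inj₁ u∈p = unique-head sp u∈p
    ... | inj₂ u∈q = unique-head sp (subst (_∈ᵥ p) (sym (meet (here refl) u∈q)) (end∈ p))

  simple-split : ∀ {u m w} (p : Walk u m) (q : Walk m w) → Simple (p ++ᵂ q) →
    Simple p × Simple q × (∀ {z} → z ∈ᵥ p → z ∈ᵥ q → z ≡ m)
  simple-split (nil m) q s = trivial-simple m , s , λ { (here z≡m) _ → z≡m }
  simple-split {m = m} (cons u u~ p) q s with simple-split p q (unique-tail s)
  ... | sp , sq , meet = unique-∷ (λ u∈p → unique-head s (∈-++ᵂˡ p q u∈p)) sp , sq , meet′
    where
    meet′ : ∀ {z} → z ∈ᵥ cons u u~ p → z ∈ᵥ q → z ≡ m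
    meet′ (here refl) z∈q = ⊥-elim (unique-head s (∈-++ᵂʳ p q z∈q))
    meet′ (there z∈p) z∈q = meet z∈p z∈q

  rev : ∀ {u w} → Walk u w → Walk w u
  rev (nil u) = nil u
  rev (cons u u~ p) = rev p ++ᵂ cons _ (Adj-sym u~) (nil u)

  ∈-rev⁻ : ∀ {u w z} (p : Walk u w) → z ∈ᵥ rev p → z ∈ᵥ p
  ∈-rev⁻ (nil u) z∈ = z∈
  ∈-rev⁻ (cons u u~ p) z∈ with ∈-++ᵂ⁻ (rev p) (cons _ (Adj-sym u~) (nil u)) z∈
  ... | inj₁ z∈rp = there (∈-rev⁻ p z∈rp)
  ... | inj₂ (here refl) = there (start∈ p)
  ... | inj₂ (there (here z≡u)) = here z≡u

  ∈-rev⁺ : ∀ {u w z} (p : Walk u w) → z ∈ᵥ p → z ∈ᵥ rev p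
  ∈-rev⁺ (nil u) z∈ = z∈
  ∈-rev⁺ (cons u u~ p) (here z≡u) = ∈-++ᵂʳ (rev p) (cons _ (Adj-sym u~) (nil u)) (there (here z≡u))
  ∈-rev⁺ (cons u u~ p) (there z∈p) = ∈-++ᵂˡ (rev p) (cons _ (Adj-sym u~) (nil u)) (∈-rev⁺ p z∈p)

  simple-rev : ∀ {u w} (p : Walk u w) → Simple p → Simple (rev p)
  simple-rev (nil u) s = s
  simple-rev (cons u {v} u~ p) s =
    simple-++ (rev p) (cons v (Adj-sym u~) (nil u)) (simple-rev p (unique-tail s))
      (unique-∷ (λ { (here v≡u) → Adj-irrefl u~ (sym v≡u) }) (trivial-simple u))
      λ { _ (here z≡v) → z≡v ; z∈rp (there (here refl)) → ⊥-elim (unique-head s (∈-rev⁻ p z∈rp)) }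

  split : ∀ {u w z} (p : Walk u w) → z ∈ᵥ p → Σ (Walk u z) λ p₁ → Σ (Walk z w) λ p₂ → p ≡ p₁ ++ᵂ p₂
  split (nil u) (here refl) = nil u , nil u , refl
  split (cons u u~ p) (here refl) = nil u , cons u u~ p , refl
  split (cons u u~ p) (there z∈p) with split p z∈p
  ... | p₁ , p₂ , refl = cons u u~ p₁ , p₂ , refl

  suffix-from : ∀ {u w z} (p : Walk u w) → Simple p → z ∈ᵥ p →
    Σ (Walk z w) λ q → Simple q × verts q ⊆ₗ verts p
  suffix-from p sp z∈p with split p z∈p
  ... | p₁ , p₂ , refl = p₂ , proj₁ (proj₂ (simple-split p₁ p₂ sp)) , ∈-++ᵂʳ p₁ p₂

  record Segment {u w} (p : Walk u w) (a b : V) : Set where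
    constructor segment
    field
      before : Walk u a
      middle : Walk a b
      after  : Walk b w
      decomposition : p ≡ before ++ᵂ middle ++ᵂ after

  segment-between : ∀ {u w y z} (p : Walk u w) → y ∈ᵥ p → z ∈ᵥ p → Segment p y z ⊎ Segment p z y
  segment-between p y∈p z∈p with split p y∈p
  ... | p₁ , p₂ , refl with ∈-++ᵂ⁻ p₁ p₂ z∈p
  ... | inj₂ z∈p₂ with split p₂ z∈p₂
  ...   | c , b , refl = inj₁ (segment p₁ c b refl)
  segment-between p y∈p z∈p | p₁ , p₂ , refl | inj₁ z∈p₁ with split p₁ z∈p₁
  ...   | a , c , refl = inj₂ (segment a c p₂ (++ᵂ-assoc a c p₂))

  -- Following a walk from x until the first vertex satisfying a decidable
  -- property D, and shortcutting repetitions, yields a path from x whose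
  -- only D-vertex is its end.
  record FirstHit (D : V → Set) (x : V) (vs : List V) : Set where
    constructor first-hit
    field
      target   : V
      target-D : D target
      path     : Walk x target
      simple   : Simple path
      within   : verts path ⊆ₗ vs
      only     : ∀ {z} → z ∈ᵥ path → D z → z ≡ target

  first-hit-along : ∀ {D : V → Set} → (∀ z → Dec (D z)) →
    ∀ {x t} (p : Walk x t) → D t → FirstHit D x (verts p)
  first-hit-along D? (nil x) Dx =
    first-hit x Dx (nil x) (trivial-simple x) (λ z∈ → z∈) (λ { (here z≡x) _ → z≡x })
  first-hit-along D? (cons x x~ p) Dt with D? x
  ... | yes Dx =
    first-hit x Dx (nil x) (trivial-simple x) (λ { (here z≡x) → here z≡x }) (λ { (here z≡x) _ → z≡x })
  ... | no ¬Dx with first-hit-along D? p Dt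
  ...   | first-hit z Dz q sq q⊆p only with x ∈ₗ? verts q
  ...     | yes x∈q with suffix-from q sq x∈q
  ...       | r , sr , r⊆q = first-hit z Dz r sr (λ w∈r → there (q⊆p (r⊆q w∈r))) (λ w∈r → only (r⊆q w∈r))
  first-hit-along {D} D? (cons x x~ p) Dt | no ¬Dx | first-hit z Dz q sq q⊆p only | no x∉q =
    first-hit z Dz (cons x x~ q) (unique-∷ x∉q sq) extended-within extended-only
    where
    extended-within : verts (cons x x~ q) ⊆ₗ verts (cons x x~ p)
    extended-within (here w≡x) = here w≡x
    extended-within (there w∈q) = there (q⊆p w∈q)
    extended-only : ∀ {w} → w ∈ᵥ cons x x~ q → D w → w ≡ z
    extended-only (here refl) Dw = ⊥-elim (¬Dx Dw)
    extended-only (there w∈q) Dw = only w∈q Dw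

  replace-segment : ∀ {u a b v} (A : Walk u a) (C M : Walk a b) (B : Walk b v) → a ≢ b →
    Simple (A ++ᵂ C ++ᵂ B) → Simple M →
    (∀ {w} → w ∈ᵥ M → w ∈ᵥ A ++ᵂ C ++ᵂ B → w ≡ a ⊎ w ≡ b) →
    Simple (A ++ᵂ M ++ᵂ B)
  replace-segment {a = a} {b} A C M B a≢b sP sM M∩P with simple-split A (C ++ᵂ B) sP
  ... | sA , sCB , A∩CB with simple-split C B sCB
  ... | _ , sB , C∩B = simple-++ A (M ++ᵂ B) sA (simple-++ M B sM sB M∩B) A∩MB
    where
    M∩B : ∀ {w} → w ∈ᵥ M → w ∈ᵥ B → w ≡ b
    M∩B w∈M w∈B with M∩P w∈M (∈-++ᵂʳ A (C ++ᵂ B) (∈-++ᵂʳ C B w∈B))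
    ... | inj₁ refl = ⊥-elim (a≢b (C∩B (start∈ C) w∈B))
    ... | inj₂ w≡b = w≡b
    A∩MB : ∀ {w} → w ∈ᵥ A → w ∈ᵥ M ++ᵂ B → w ≡ a
    A∩MB w∈A w∈MB with ∈-++ᵂ⁻ M B w∈MB
    ... | inj₂ w∈B = A∩CB w∈A (∈-++ᵂʳ C B w∈B)
    ... | inj₁ w∈M with M∩P w∈M (∈-++ᵂˡ A (C ++ᵂ B) w∈A)
    ...   | inj₁ w≡a = w≡a
    ...   | inj₂ refl = ⊥-elim (a≢b (sym (A∩CB w∈A (∈-++ᵂˡ C B (end∈ C)))))

  Within : ∀ {u w} → (V → Set) → Walk u w → Set
  Within Q p = ∀ {z} → z ∈ᵥ p → Q z

  linked⇒walk : ∀ {Q : V → Set} u mid w → Q u → All Q mid → Q w →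
    Linked (Adj G) (u ∷ mid ++ [ w ]) → Σ (Walk u w) (Within Q)
  linked⇒walk u [] w Qu [] Qw (u~w ∷ [-]) =
    cons u u~w (nil w) , λ { (here refl) → Qu ; (there (here refl)) → Qw }
  linked⇒walk u (m ∷ mid) w Qu (Qm ∷ Qmid) Qw (u~m ∷ rest) with linked⇒walk m mid w Qm Qmid Qw rest
  ... | p , p-within = cons u u~m p , λ { (here refl) → Qu ; (there z∈p) → p-within z∈p }

  connected⇒walk : ∀ {Q : V → Set} → InducedConnected G Q → ∀ {u w} → Q u → Q w → Σ (Walk u w) (Within Q)
  connected⇒walk conn {u} {w} Qu Qw with conn u w Qu Qw
  ... | inj₁ refl = nil u , λ { (here refl) → Qu }
  ... | inj₂ (mid , Qmid , linked) = linked⇒walk u mid w Qu Qmid Qw linked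

  linked-verts : ∀ {u w} (p : Walk u w) → Linked (Adj G) (verts p)
  linked-verts (nil u) = [-]
  linked-verts (cons u u~ (nil v)) = u~ ∷ [-]
  linked-verts (cons u u~ (cons v v~ p)) = u~ ∷ linked-verts (cons v v~ p)

  last-verts : ∀ {u w} (p : Walk u w) → last (verts p) ≡ just w
  last-verts (nil u) = refl
  last-verts (cons u u~ (nil v)) = refl
  last-verts (cons u u~ (cons v v~ p)) = last-verts (cons v v~ p)

  init-verts : ∀ {u w} (p : Walk u w) → Σ (List V) λ xs → verts p ≡ xs ++ [ w ]
  init-verts (nil u) = [] , refl
  init-verts (cons u u~ p) with init-verts p
  ... | xs , eq = u ∷ xs , cong (u ∷_) eq

  interior : ∀ {a b} (p : Walk a b) → a ≢ b → Σ (List V) λ mid → verts p ≡ a ∷ mid ++ [ b ]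
  interior (nil a) a≢a = ⊥-elim (a≢a refl)
  interior (cons a a~ p) _ with init-verts p
  ... | mid , eq = mid , cong (a ∷_) eq

  neighbour-towards : ∀ {Q : V → Set} → InducedConnected G Q → ∀ {v r} → Q v → Q r → v ≢ r →
    ∃[ a ] Adj G v a × Q a
  neighbour-towards connected Qv Qr v≢r with connected⇒walk connected Qv Qr
  ... | nil _ , _ = ⊥-elim (v≢r refl)
  ... | cons _ v~a p , p-within = _ , v~a , p-within (there (start∈ p))

  endpoint-other-than : ∀ {u v} y (p : Walk u v) → u ≢ v → ∃[ t ] t ∈ᵥ p × t ≢ y
  endpoint-other-than {u} {v} y p u≢v with y ≟ᶠ u
  ... | yes refl = v , end∈ p , λ v≡y → u≢v (sym v≡y)
  ... | no y≢u = u , start∈ p , λ u≡y → y≢u (sym u≡y)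

-- Rerouting in a vertex set P that stays connected after deleting any one
-- vertex: paths through a vertex can be redirected through its neighbours.
module Rerouting {N : ℕ} (G : Graph N) (P : Fin N → Set)
  (connected-without : ∀ y → P y → InducedConnected G (λ z → P z × z ≢ y)) where
  open Walks G

  record Through (u v x : V) : Set where
    constructor through
    field
      path   : Walk u v
      simple : Simple path
      inside : Within P path
      visits : x ∈ᵥ path

  splice : ∀ {u v a b x} (p : Walk u v) → Segment p a b → a ≢ b → Simple p → Within P p →
    (M : Walk a b) → Simple M → Within P M → x ∈ᵥ M →
    (∀ {w} → w ∈ᵥ M → w ∈ᵥ p → w ≡ a ⊎ w ≡ b) → Through u v x
  splice p (segment A C B refl) a≢b sp p-inside M sM M-inside x∈M M∩p =
    through (A ++ᵂ M ++ᵂ B) (replace-segment A C M B a≢b sp sM M∩p) inside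
      (∈-++ᵂʳ A (M ++ᵂ B) (∈-++ᵂˡ M B x∈M))
    where
    inside : Within P (A ++ᵂ M ++ᵂ B)
    inside w∈ with ∈-++ᵂ⁻ A (M ++ᵂ B) w∈
    ... | inj₁ w∈A = p-inside (∈-++ᵂˡ A (C ++ᵂ B) w∈A)
    ... | inj₂ w∈MB with ∈-++ᵂ⁻ M B w∈MB
    ...   | inj₁ w∈M = M-inside w∈M
    ...   | inj₂ w∈B = p-inside (∈-++ᵂʳ A (C ++ᵂ B) (∈-++ᵂʳ C B w∈B))

  record Detour {u v} (p : Walk u v) (y x : V) : Set where
    constructor detour
    field
      {rejoin} : V
      rejoin∈p : rejoin ∈ᵥ p
      y≢rejoin : y ≢ rejoin
      route    : Walk y rejoin
      simple   : Simple route
      inside   : Within P route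
      visits   : x ∈ᵥ route
      meets    : ∀ {w} → w ∈ᵥ route → w ∈ᵥ p → w ≡ y ⊎ w ≡ rejoin

  -- A detour through any P-neighbour x of y exists: since P without y is
  -- connected, x reaches a vertex t ≢ y of p avoiding y; cut this walk at
  -- its first vertex z on p and prepend the edge y – x.
  find-detour : ∀ {u v y x} (p : Walk u v) → u ≢ v → Within P p → y ∈ᵥ p → P x → Adj G y x →
    Detour p y x
  find-detour {y = y} {x} p u≢v p-inside y∈p Px y~x with endpoint-other-than y p u≢v
  ... | t , t∈p , t≢y
    with connected⇒walk (connected-without y (p-inside y∈p))
           (Px , λ x≡y → Adj-irrefl y~x (sym x≡y)) (p-inside t∈p , t≢y)
  ... | r , r-avoids with first-hit-along (_∈ₗ? verts p) r t∈p
  ... | first-hit z z∈p q sq q⊆r q-only =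
    detour z∈p y≢z (cons y y~x q) (unique-∷ (λ y∈q → proj₂ (q-avoids y∈q) refl) sq)
      route-inside (there (start∈ q)) meets
    where
    q-avoids : Within (λ w → P w × w ≢ y) q
    q-avoids w∈q = r-avoids (q⊆r w∈q)
    y≢z : y ≢ z
    y≢z y≡z = proj₂ (q-avoids (end∈ q)) (sym y≡z)
    route-inside : Within P (cons y y~x q)
    route-inside (here refl) = p-inside y∈p
    route-inside (there w∈q) = proj₁ (q-avoids w∈q)
    meets : ∀ {w} → w ∈ᵥ cons y y~x q → w ∈ᵥ p → w ≡ y ⊎ w ≡ z
    meets (here w≡y) _ = inj₁ w≡y
    meets (there w∈q) w∈p = inj₂ (q-only w∈q w∈p)

  -- If a u → v path inside P visits y and x ∈ P is a neighbour of y, some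
  -- u → v path inside P visits x: splice a detour through x into the
  -- segment between y and the rejoining vertex, in whichever direction the
  -- path traverses it.
  reroute-step : ∀ {u v y x} → u ≢ v → P x → Adj G y x → Through u v y → Through u v x
  reroute-step u≢v Px y~x (through p sp p-inside y∈p)
    with find-detour p u≢v p-inside y∈p Px y~x
  ... | detour z∈p y≢z d sd d-inside x∈d d∩p with segment-between p y∈p z∈p
  ... | inj₁ y⋯z = splice p y⋯z y≢z sp p-inside d sd d-inside x∈d d∩p
  ... | inj₂ z⋯y =
    splice p z⋯y (λ z≡y → y≢z (sym z≡y)) sp p-inside (rev d) (simple-rev d sd)
      (λ w∈ → d-inside (∈-rev⁻ d w∈)) (∈-rev⁺ d x∈d)
      (λ w∈ w∈p → swap (d∩p (∈-rev⁻ d w∈) w∈p))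

  reroute : ∀ {u v y x} → u ≢ v → (r : Walk y x) → Within P r → Through u v y → Through u v x
  reroute u≢v (nil _) _ th = th
  reroute u≢v (cons y y~ r) r-inside th =
    reroute u≢v r (λ w∈r → r-inside (there w∈r)) (reroute-step u≢v (r-inside (there (start∈ r))) y~ th)

  -- If moreover P is connected, then for every edge v – w inside P and every
  -- x ∈ P some v → w path inside P visits x (so the edge and x lie on a
  -- common cycle).
  path-through : InducedConnected G P → ∀ {v w x} → Adj G v w → P v → P w → P x → Through v w x
  path-through connected {v} {w} v~w Pv Pw Px with connected⇒walk connected Pv Px
  ... | r , r-inside = reroute (Adj-irrefl v~w) r r-inside (through edge simple-edge edge-inside (here refl))
    where
    edge : Walk v w
    edge = cons v v~w (nil w)
    simple-edge : Simple edge
    simple-edge = unique-∷ (λ { (here v≡w) → Adj-irrefl v~w v≡w }) (trivial-simple w)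
    edge-inside : Within P edge
    edge-inside (here refl) = Pv
    edge-inside (there (here refl)) = Pw

module Excursions {N : ℕ} (G : Graph N) where
  open Walks G

  record Excursion (S : Subset N) (x : V) (vs : List V) : Set where
    constructor excursion
    field
      {from to} : V
      path      : Walk from to
      simple    : Simple path
      from∈S    : from ∈ S
      to∈S      : to ∈ S
      from≢to   : from ≢ to
      visits    : x ∈ᵥ path
      ends-only : ∀ {z} → z ∈ᵥ path → z ∈ S → z ≡ from ⊎ z ≡ to
      within    : verts path ⊆ₗ vs

  -- A path between two vertices of S through a vertex x ∉ S contains an
  -- excursion through x: walk from x backwards and forwards along the path
  -- up to the first vertex of S in each direction.
  find-excursion : ∀ {S v w x} (p : Walk v w) → Simple p → v ∈ S → w ∈ S → x ∈ᵥ p → x ∉ S →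
    Excursion S x (verts p)
  find-excursion {S} {x = x} p sp v∈S w∈S x∈p x∉S with split p x∈p
  ... | p₁ , p₂ , refl
    with simple-split p₁ p₂ sp | first-hit-along (_∈ˢ? S) (rev p₁) v∈S | first-hit-along (_∈ˢ? S) p₂ w∈S
  ... | _ , _ , p₁∩p₂ | first-hit a a∈S A sA A⊆ A-only | first-hit b b∈S B sB B⊆ B-only =
    excursion (rev A ++ᵂ B) (simple-++ (rev A) B (simple-rev A sA) sB A∩B) a∈S b∈S a≢b
      (∈-++ᵂʳ (rev A) B (start∈ B)) ends-only within
    where
    in-p₁ : ∀ {z} → z ∈ᵥ rev A → z ∈ᵥ p₁
    in-p₁ z∈ = ∈-rev⁻ p₁ (A⊆ (∈-rev⁻ A z∈))
    A∩B : ∀ {z} → z ∈ᵥ rev A → z ∈ᵥ B → z ≡ x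
    A∩B z∈A z∈B = p₁∩p₂ (in-p₁ z∈A) (B⊆ z∈B)
    a≢b : a ≢ b
    a≢b refl = x∉S (subst (_∈ S) (A∩B (∈-rev⁺ A (end∈ A)) (end∈ B)) a∈S)
    ends-only : ∀ {z} → z ∈ᵥ rev A ++ᵂ B → z ∈ S → z ≡ a ⊎ z ≡ b
    ends-only z∈ z∈S with ∈-++ᵂ⁻ (rev A) B z∈
    ... | inj₁ z∈A = inj₁ (A-only (∈-rev⁻ A z∈A) z∈S)
    ... | inj₂ z∈B = inj₂ (B-only z∈B z∈S)
    within : verts (rev A ++ᵂ B) ⊆ₗ verts (p₁ ++ᵂ p₂)
    within z∈ with ∈-++ᵂ⁻ (rev A) B z∈
    ... | inj₁ z∈A = ∈-++ᵂˡ p₁ p₂ (in-p₁ z∈A)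
    ... | inj₂ z∈B = ∈-++ᵂʳ p₁ p₂ (B⊆ z∈B)

  excursion-length : ∀ {k S x vs} → FarApart G k S → x ∉ S → (e : Excursion S x vs) →
    let n = length (verts (Excursion.path e)) in suc (2 * k) ≤ n × 3 ≤ n
  excursion-length {k} {S} {x} far x∉S (excursion {a} {b} E sE a∈S b∈S a≢b x∈E ends-only _)
    with interior E a≢b
  ... | mid , eq = subst (suc (2 * k) ≤_) length-E (s≤s far-apart) , subst (3 ≤_) length-E three
    where
    unique-E : Unique (a ∷ mid ++ [ b ])
    unique-E = subst Unique eq sE
    in-E : ∀ {z} → z ∈ₗ mid → z ∈ᵥ E
    in-E z∈mid = subst (_ ∈ₗ_) (sym eq) (there (∈-++⁺ˡ z∈mid))
    mid-outside : All (_∉ S) mid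
    mid-outside = All.tabulate λ z∈mid z∈S → [ (λ { refl → unique-head unique-E (∈-++⁺ˡ z∈mid) })
                                         , (λ { refl → unique-last mid (unique-tail unique-E) z∈mid }) ]′
                                         (ends-only (in-E z∈mid) z∈S)
    x∈mid : x ∈ₗ mid
    x∈mid with subst (x ∈ₗ_) eq x∈E
    ... | here refl = ⊥-elim (x∉S a∈S)
    ... | there x∈ with ∈-++⁻ mid x∈
    ...   | inj₁ x∈mid = x∈mid
    ...   | inj₂ (here refl) = ⊥-elim (x∉S b∈S)
    far-apart : 2 * k ≤ length mid + 1
    far-apart = far a b a∈S b∈S a≢b mid (λ { refl → case-∈[] x∈mid }) mid-outside unique-E
                  (subst (Linked (Adj G)) eq (linked-verts E))
      where case-∈[] : x ∈ₗ [] → ⊥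
            case-∈[] ()
    length-E : suc (length mid + 1) ≡ length (verts E)
    length-E = sym (trans (cong length eq) (cong suc (length-++ mid)))
    three : 3 ≤ suc (length mid + 1)
    three = s≤s (+-monoˡ-≤ 1 (nonempty x∈mid))
      where nonempty : ∀ {xs : List V} → x ∈ₗ xs → 1 ≤ length xs
            nonempty (here _) = s≤s z≤n
            nonempty (there _) = s≤s z≤n

module Spots {N : ℕ} (G : Graph N) where
  open Walks G
  open Excursions G

  close-cycle : ∀ {k T v w} (p : Walk v w) → Adj G w v → Simple p → Within (_∈ T) p →
    3 ≤ length (verts p) → k ≤ length (verts p) → HasLongCycle G k T
  close-cycle (nil v) _ _ _ (s≤s ()) _
  close-cycle {w = w} (cons v v~ p) w~v sp p-inside three k≤ =
    v , verts p , sp , All.tabulate p-inside , linked-verts (cons v v~ p) ,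
    (w , last-verts (cons v v~ p) , w~v) , three , k≤

  spot-⊆ : ∀ {k S T v w} → IsKSpot G k S → IsKSpot G k T → Adj G v w →
    v ∈ S → w ∈ S → v ∈ T → w ∈ T → T ⊆ S
  spot-⊆ {k} {S} {T} (_ , _ , far) (no-cycle , (_ , connected , connected-without) , _)
    v~w v∈S w∈S v∈T w∈T {x} x∈T with x ∈ˢ? S
  ... | yes x∈S = x∈S
  ... | no x∉S with Rerouting.path-through G (_∈ T) connected-without connected v~w v∈T w∈T x∈T
  ... | Rerouting.through p sp p-inside x∈p with find-excursion p sp v∈S w∈S x∈p x∉S
  ... | e with excursion-length {k} far x∉S e
  ... | long , three =
    ⊥-elim (no-cycle (close-cycle p (Adj-sym v~w) sp p-inside (≤-trans three e≤p)
      (≤-trans (m≤n⇒m≤1+n (m≤n*m k 2)) (≤-trans long e≤p))))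
    where
    e≤p : length (verts (Excursion.path e)) ≤ length (verts p)
    e≤p = unique-⊆⇒length≤ (Excursion.simple e) (Excursion.within e)

  spots-sharing-an-edge-coincide : ∀ {k S T v w} → IsKSpot G k S → IsKSpot G k T → Adj G v w →
    v ∈ S → w ∈ S → v ∈ T → w ∈ T → S ≡ T
  spots-sharing-an-edge-coincide S-spot T-spot v~w v∈S w∈S v∈T w∈T =
    ⊆-antisym (spot-⊆ T-spot S-spot v~w v∈T w∈T v∈S w∈S) (spot-⊆ S-spot T-spot v~w v∈S w∈S v∈T w∈T)

  -- In a 2-connected set S with at least three vertices every vertex v ∈ S
  -- has two distinct neighbours in S: one on a path inside S towards some
  -- other vertex, and one on a path inside S ∖ {a} towards a third vertex.
  two-neighbours : ∀ {S v} → 3 ≤ ∣ S ∣ → TwoConnected G S → v ∈ S →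
    ∃[ a ] ∃[ b ] a ≢ b × (Adj G v a × a ∈ S) × (Adj G v b × b ∈ S)
  two-neighbours {S} {v} three (connected , connected-without) v∈S
    with fresh S [ v ] (≤-trans (n≤1+n 2) three)
  ... | r , r∈S , r∉[v] with neighbour-towards connected v∈S r∈S (λ v≡r → r∉[v] (here (sym v≡r)))
  ... | a , v~a , a∈S with fresh S (v ∷ a ∷ []) three
  ... | r′ , r′∈S , r′∉[v,a]
    with neighbour-towards (connected-without a a∈S) (v∈S , Adj-irrefl v~a) (r′∈S , λ r′≡a → r′∉[v,a] (there (here r′≡a)))
           (λ v≡r′ → r′∉[v,a] (here (sym v≡r′)))
  ... | b , v~b , b∈S , b≢a = a , b , (λ a≡b → b≢a (sym a≡b)) , (v~a , a∈S) , (v~b , b∈S)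

  -- First claim: the k-spots containing v have pairwise distinct
  -- neighbours of v as witnesses, two per spot.
  spots-at-vertex : ∀ k v (Ss : List (Subset N)) → Unique Ss →
    All (λ S → IsKSpot G k S × v ∈ S) Ss → 2 * length Ss ≤ degree G v
  spots-at-vertex k v Ss uSs spots =
    subst (2 * length Ss ≤_) (length-elements neighbours)
      (witness-count Owns 2 (elements neighbours) private-witness from-neighbours Ss uSs
        (All.map two-witnesses spots))
    where
    neighbours : Subset N
    neighbours = tabulate (Graph.adj G v)
    Owns : Subset N → V → Set
    Owns S z = (IsKSpot G k S × v ∈ S) × Adj G v z × z ∈ S
    private-witness : ∀ {S T z} → Owns S z → Owns T z → S ≡ T
    private-witness ((S-spot , v∈S) , v~z , z∈S) ((T-spot , v∈T) , _ , z∈T) =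
      spots-sharing-an-edge-coincide S-spot T-spot v~z v∈S z∈S v∈T z∈T
    from-neighbours : ∀ {S z} → Owns S z → z ∈ₗ elements neighbours
    from-neighbours {z = z} (_ , v~z , _) = ∈-elements⁺ neighbours
      (lookup⇒[]= z neighbours (trans (lookup∘tabulate (Graph.adj G v) z) (Equivalence.to T-≡ v~z)))
    two-witnesses : ∀ {S} → IsKSpot G k S × v ∈ S → Witnessed Owns 2 S
    two-witnesses S-spot@((_ , (three , two-connected) , _) , v∈S)
      with two-neighbours three two-connected v∈S
    ... | a , b , a≢b , (v~a , a∈S) , (v~b , b∈S) =
      a ∷ b ∷ [] , unique-∷ (λ { (here a≡b) → a≢b a≡b }) (unique-∷ (λ ()) []) , refl ,
      (S-spot , v~a , a∈S) ∷ (S-spot , v~b , b∈S) ∷ []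

  -- Second claim: every k-spot contains an edge, and distinct k-spots
  -- contain distinct edges.
  spots-total : ∀ k (Ss : List (Subset N)) → Unique Ss → All (IsKSpot G k) Ss →
    length Ss ≤ edgeCount G
  spots-total k Ss uSs spots =
    subst (_≤ edgeCount G) (*-identityˡ (length Ss))
      (witness-count Owns 1 edges private-witness from-edges Ss uSs (All.map one-witness spots))
    where
    is-edge : V × V → Bool
    is-edge (u , w) = (toℕ u <ᵇ toℕ w) ∧ Graph.adj G u w
    edges : List (V × V)
    edges = filterᵇ is-edge (cartesianProduct (allFin N) (allFin N))
    Owns : Subset N → V × V → Set
    Owns S (u , w) = IsKSpot G k S × u ∈ S × w ∈ S × Adj G u w × toℕ u < toℕ w
    private-witness : ∀ {S T e} → Owns S e → Owns T e → S ≡ T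
    private-witness (S-spot , u∈S , w∈S , u~w , _) (T-spot , u∈T , w∈T , _) =
      spots-sharing-an-edge-coincide S-spot T-spot u~w u∈S w∈S u∈T w∈T
    from-edges : ∀ {S e} → Owns S e → e ∈ₗ edges
    from-edges {e = u , w} (_ , _ , _ , u~w , u<w) =
      ∈-filter⁺ (λ e → T? (is-edge e)) (∈-cartesianProduct⁺ (∈-allFin u) (∈-allFin w))
        (Equivalence.from T-∧ (<⇒<ᵇ u<w , u~w))
    one-witness : ∀ {S} → IsKSpot G k S → Witnessed Owns 1 S
    one-witness {S} S-spot@(_ , (three , two-connected) , _) with fresh S [] (≤-trans (s≤s z≤n) three)
    ... | v , v∈S , _ with two-neighbours three two-connected v∈S
    ... | a , _ , _ , (v~a , a∈S) , _ with <-cmp (toℕ v) (toℕ a)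
    ... | tri< v<a _ _ = [ v , a ] , unique-∷ (λ ()) [] , refl , (S-spot , v∈S , a∈S , v~a , v<a) ∷ []
    ... | tri≈ _ v≡a _ = ⊥-elim (Adj-irrefl v~a (toℕ-injective v≡a))
    ... | tri> _ _ a<v = [ a , v ] , unique-∷ (λ ()) [] , refl , (S-spot , a∈S , v∈S , Adj-sym v~a , a<v) ∷ []

-- The theorem.  The argument works for every k.
corollary5p5 : (k : ℕ) → 4 ≤ k → (N : ℕ) → (G : Graph N) →
    ((v : Fin N) → (Ss : List (Subset N)) → Unique Ss →
    All (λ S → IsKSpot G k S × v ∈ S) Ss → 2 * length Ss ≤ degree G v)
    × ((Ss : List (Subset N)) → Unique Ss → All (IsKSpot G k) Ss →
    length Ss ≤ edgeCount G)
corollary5p5 k _ N G = Spots.spots-at-vertex G k , Spots.spots-total G k
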